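{- Let $n\geq 3$, $i\in\{1,\dots,n\}$, and let $w_iv$ be an edge of the complement of $D_n$. Then $\gamma_{tR}(D_n+w_iv)<\gamma_{tR}(D_n)$.
   Context: All graphs are finite and simple. For $n\geq 2$, $D_n$ is the graph with vertices $c,u_1,\dots,u_n,v_1,\dots,v_n,w_1,\dots,w_n$ and edges $cu_i, cv_i, u_iv_i, u_iw_i, v_iw_i$ for $1\leq i\leq n$ (i.e. $n$ copies of $K_4-e$ sharing the vertex $c$, where $w_i$ has degree $2$). A total Roman dominating function on a graph with no isolated vertices is a map $f:V\to\{0,1,2\}$ such that every vertex with $f(v)=0$ is adjacent to a vertex $u$ with $f(u)=2$, and the subgraph induced by $\{v:f(v)>0\}$ has no isolated vertices; $\gamma_{tR}$ is the minimum of $\sum_v f(v)$ over such functions. -}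

module Defs where

open import Data.Nat using (ℕ; zero; suc; _+_; _≤_; _<_)
open import Data.Fin using (Fin)
open import Data.List using (List; map; allFin)
open import Data.Nat.ListAction using (sum)
open import Data.Product using (Σ; _×_)
open import Data.Sum using (_⊎_)
open import Relation.Binary.PropositionalEquality using (_≡_)
open import Relation.Nullary using (¬_)

data Vtx (n : ℕ) : Set where
  c : Vtx n
  u : Fin n → Vtx n
  v : Fin n → Vtx n
  w : Fin n → Vtx n

data DAdj {n : ℕ} : Vtx n → Vtx n → Set where
  cu : ∀ i → DAdj c (u i)
  uc : ∀ i → DAdj (u i) c
  cv : ∀ i → DAdj c (v i)
  vc : ∀ i → DAdj (v i) c
  uv : ∀ i → DAdj (u i) (v i)
  vu : ∀ i → DAdj (v i) (u i)
  uw : ∀ i → DAdj (u i) (w i)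
  wu : ∀ i → DAdj (w i) (u i)
  vw : ∀ i → DAdj (v i) (w i)
  wv : ∀ i → DAdj (w i) (v i)

Graph : Set → Set₁
Graph V = V → V → Set

D : (n : ℕ) → Graph (Vtx n)
D n = DAdj

addEdge : {V : Set} → Graph V → V → V → Graph V
addEdge G a b x y = G x y ⊎ ((x ≡ a × y ≡ b) ⊎ (x ≡ b × y ≡ a))

IsComplementEdge : {V : Set} → Graph V → V → V → Set
IsComplementEdge G a b = ¬ (a ≡ b) × ¬ G a b

record IsTRDF {V : Set} (G : Graph V) (f : V → ℕ) : Set where
  field
    values   : ∀ x → f x ≤ 2
    dominate : ∀ x → f x ≡ 0 → Σ V (λ y → G x y × f y ≡ 2)
    total    : ∀ x → 0 < f x → Σ V (λ y → G x y × 0 < f y)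

weight : {n : ℕ} → (Vtx n → ℕ) → ℕ
weight {n} f = f c + sum (map (λ i → f (u i) + f (v i) + f (w i)) (allFin n))

IsγtR : {n : ℕ} → Graph (Vtx n) → ℕ → Set
IsγtR {n} G k =
  Σ (Vtx n → ℕ) (λ f → IsTRDF G f × weight f ≡ k)
  × (∀ (g : Vtx n → ℕ) → IsTRDF G g → k ≤ weight g)

-- Write the weight of f as f(c) plus the gadget weights f(u_k) + f(v_k) + f(w_k).
-- In a total Roman dominating function every vertex x has a neighbour y with
-- f(x) + f(y) ≥ 2; at w_k this makes every gadget weigh at least 2 as long as w_k
-- keeps its neighbourhood.  In D_n that gives 2n + f(c) ≥ 2n + 1 when f(c) ≥ 1, and
-- when f(c) = 0 the dominator of c and its positive neighbour make one gadget weigh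
-- 3; c ↦ 1, u_k ↦ 2 attains 2n + 1.  In D_n + w_i x every gadget still weighs 2 if
-- f(c) ≤ 1 (through u_k and v_k for a gadget whose w_k is an end of the new edge),
-- while f(c) ≥ 2 pays for the gadgets at the new edge, so the weight is at least 2n.
-- This is attained by 2 on c and on one spoke of every gadget but the i-th, w_i being
-- dominated across the new edge; for x = w_j, w_i and w_j instead get 1 each.
module Submission where

open import Defs
open import Data.Bool.Base using (Bool; true; false; if_then_else_)
open import Data.Fin.Base using (Fin; zero; suc; punchIn; punchOut)
open import Data.Fin.Properties using (_≟_; punchInᵢ≢i; punchIn-punchOut; punchIn-injective)
open import Data.List.Base using (tabulate)
open import Data.List.Properties using (map-tabulate)
import Data.Nat.ListAction as List
open import Data.Nat.Base using (ℕ; zero; suc; _+_; _*_; _≤_; _<_; z≤n; s≤s; z<s)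
open import Data.Nat.Properties hiding (_≟_)
import Data.Nat.Properties as ℕ
open import Algebra.Properties.CommutativeMonoid.Sum +-0-commutativeMonoid
  using (sum; sum-remove; sum-cong-≗)
open import Data.Product.Base using (Σ; _×_; _,_)
open import Data.Sum.Base using (_⊎_; inj₁; inj₂; [_,_])
open import Data.Vec.Functional using (Vector; removeAt)
open import Function.Base using (_∘_; id)
open import Relation.Binary.PropositionalEquality
  using (_≡_; _≢_; refl; sym; trans; cong; cong₂; subst; module ≡-Reasoning)
open import Relation.Nullary.Decidable using (yes; no; does; dec-true; dec-false; _⊎-dec_)
open import Relation.Nullary.Negation using (contradiction)

sum-mono-≤ : ∀ {n} {h₁ h₂ : Vector ℕ n} → (∀ k → h₁ k ≤ h₂ k) → sum h₁ ≤ sum h₂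
sum-mono-≤ {zero}  _       = z≤n
sum-mono-≤ {suc n} h₁≤h₂ = +-mono-≤ (h₁≤h₂ zero) (sum-mono-≤ (h₁≤h₂ ∘ suc))

sum-const : ∀ n m → sum {n} (λ _ → m) ≡ n * m
sum-const zero    m = refl
sum-const (suc n) m = cong (m +_) (sum-const n m)

sum-≡ : ∀ {n m} {h : Vector ℕ n} → (∀ k → h k ≡ m) → sum h ≡ n * m
sum-≡ {n} {m} h≡m = trans (sum-cong-≗ h≡m) (sum-const n m)

sum-≥ : ∀ {n m} {h : Vector ℕ n} → (∀ k → m ≤ h k) → n * m ≤ sum h
sum-≥ {n} {m} m≤h = ≤-trans (≤-reflexive (sym (sum-const n m))) (sum-mono-≤ m≤h)

punchIn₂ : ∀ {n} {i j : Fin (suc (suc n))} → i ≢ j → Fin n → Fin (suc (suc n))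
punchIn₂ {i = i} i≢j = punchIn i ∘ punchIn (punchOut i≢j)

punchIn₂≢ˡ : ∀ {n} {i j : Fin (suc (suc n))} (i≢j : i ≢ j) k → punchIn₂ i≢j k ≢ i
punchIn₂≢ˡ {i = i} i≢j k = punchInᵢ≢i i _

punchIn₂≢ʳ : ∀ {n} {i j : Fin (suc (suc n))} (i≢j : i ≢ j) k → punchIn₂ i≢j k ≢ j
punchIn₂≢ʳ {i = i} i≢j k eq =
  punchInᵢ≢i (punchOut i≢j) k
    (punchIn-injective i _ _ (trans eq (sym (punchIn-punchOut i≢j))))

sum-remove₂ : ∀ {n} (h : Vector ℕ (suc (suc n))) {i j} (i≢j : i ≢ j) →
              sum h ≡ h i + h j + sum (h ∘ punchIn₂ i≢j)
sum-remove₂ h {i} {j} i≢j = begin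
  sum h                                                  ≡⟨ sum-remove h ⟩
  h i + sum (removeAt h i)                               ≡⟨ cong (h i +_) (sum-remove (removeAt h i)) ⟩
  h i + (h (punchIn i (punchOut i≢j)) + sum (h ∘ punchIn₂ i≢j))
    ≡⟨ cong (λ l → h i + (h l + sum (h ∘ punchIn₂ i≢j))) (punchIn-punchOut i≢j) ⟩
  h i + (h j + sum (h ∘ punchIn₂ i≢j))                   ≡⟨ sym (+-assoc (h i) _ _) ⟩
  h i + h j + sum (h ∘ punchIn₂ i≢j)                     ∎
  where open ≡-Reasoning

sum-≥-except : ∀ {n m} (h : Vector ℕ (suc n)) i → (∀ k → k ≢ i → m ≤ h k) →
               h i + n * m ≤ sum h
sum-≥-except h i m≤h = ≤-trans (+-monoʳ-≤ (h i) (sum-≥ (m≤h _ ∘ punchInᵢ≢i i)))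
                               (≤-reflexive (sym (sum-remove h)))

sum-≡-except : ∀ {n m} (h : Vector ℕ (suc n)) i → (∀ k → k ≢ i → h k ≡ m) →
               sum h ≡ h i + n * m
sum-≡-except h i h≡m =
  trans (sum-remove h) (cong (h i +_) (sum-≡ (h≡m _ ∘ punchInᵢ≢i i)))

sum-≥-except₂ : ∀ {n m} (h : Vector ℕ (suc (suc n))) {i j} (i≢j : i ≢ j) →
                (∀ k → k ≢ i → k ≢ j → m ≤ h k) → h i + h j + n * m ≤ sum h
sum-≥-except₂ h i≢j m≤h =
  ≤-trans (+-monoʳ-≤ _ (sum-≥ (λ k → m≤h _ (punchIn₂≢ˡ i≢j k) (punchIn₂≢ʳ i≢j k))))
          (≤-reflexive (sym (sum-remove₂ h i≢j)))

sum-≡-except₂ : ∀ {n m} (h : Vector ℕ (suc (suc n))) {i j} (i≢j : i ≢ j) →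
                (∀ k → k ≢ i → k ≢ j → h k ≡ m) → sum h ≡ h i + h j + n * m
sum-≡-except₂ h i≢j h≡m =
  trans (sum-remove₂ h i≢j)
        (cong (_ +_) (sum-≡ (λ k → h≡m _ (punchIn₂≢ˡ i≢j k) (punchIn₂≢ʳ i≢j k))))

List-sum-tabulate : ∀ {n} (h : Vector ℕ n) → List.sum (tabulate h) ≡ sum h
List-sum-tabulate {zero}  h = refl
List-sum-tabulate {suc n} h = cong (h zero +_) (List-sum-tabulate (h ∘ suc))

module _ {V : Set} {G : Graph V} {f : V → ℕ} (T : IsTRDF G f) where
  open IsTRDF T

  ∃-neighbour-sum≥2 : ∀ x → Σ V (λ y → G x y × 2 ≤ f x + f y)
  ∃-neighbour-sum≥2 x with f x ℕ.≟ 0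
  ... | yes fx≡0 = let y , xy , fy≡2 = dominate x fx≡0 in
                   y , xy , ≤-trans (≤-reflexive (sym fy≡2)) (m≤n+m (f y) (f x))
  ... | no fx≢0  = let y , xy , fy>0 = total x (n≢0⇒n>0 fx≢0) in
                   y , xy , +-mono-≤ (n≢0⇒n>0 fx≢0) fy>0

addEdge-≢ : ∀ {V} {G : Graph V} {a b z y : V} → z ≢ a → z ≢ b → addEdge G a b z y → G z y
addEdge-≢ z≢a z≢b (inj₁ zy)              = zy
addEdge-≢ z≢a z≢b (inj₂ (inj₁ (z≡a , _))) = contradiction z≡a z≢a
addEdge-≢ z≢a z≢b (inj₂ (inj₂ (z≡b , _))) = contradiction z≡b z≢b

-- Gadgets of D_n

gadget : ∀ {n} → (Vtx n → ℕ) → Fin n → ℕ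
gadget f k = f (u k) + f (v k) + f (w k)

weight≡centre+gadgets : ∀ {n} (f : Vtx n → ℕ) → weight f ≡ f c + sum (gadget f)
weight≡centre+gadgets f =
  cong (f c +_) (trans (cong List.sum (map-tabulate id (gadget f))) (List-sum-tabulate (gadget f)))

w-injective : ∀ {n} {k l : Fin n} → w k ≡ w l → k ≡ l
w-injective refl = refl

module _ {n} (f : Vtx n → ℕ) (k : Fin n) where

  u+v≤gadget : f (u k) + f (v k) ≤ gadget f k
  u+v≤gadget = m≤m+n (f (u k) + f (v k)) (f (w k))

  u+w≤gadget : f (u k) + f (w k) ≤ gadget f k
  u+w≤gadget = +-monoˡ-≤ (f (w k)) (m≤m+n (f (u k)) (f (v k)))

  v+w≤gadget : f (v k) + f (w k) ≤ gadget f k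
  v+w≤gadget = +-monoˡ-≤ (f (w k)) (m≤n+m (f (v k)) (f (u k)))

  v+u≤gadget : f (v k) + f (u k) ≤ gadget f k
  v+u≤gadget = ≤-trans (≤-reflexive (+-comm (f (v k)) (f (u k)))) u+v≤gadget

  w+u≤gadget : f (w k) + f (u k) ≤ gadget f k
  w+u≤gadget = ≤-trans (≤-reflexive (+-comm (f (w k)) (f (u k)))) u+w≤gadget

  w+v≤gadget : f (w k) + f (v k) ≤ gadget f k
  w+v≤gadget = ≤-trans (≤-reflexive (+-comm (f (w k)) (f (v k)))) v+w≤gadget

NoNewNeighbours : ∀ {n} → Graph (Vtx n) → Vtx n → Set
NoNewNeighbours {n} G z = ∀ {y} → G z y → D n z y

addEdge-noNewNeighbours : ∀ {n} {a b z : Vtx n} → z ≢ a → z ≢ b →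
                          NoNewNeighbours (addEdge (D n) a b) z
addEdge-noNewNeighbours z≢a z≢b = addEdge-≢ {G = D _} z≢a z≢b

module _ {n} {G : Graph (Vtx n)} {g : Vtx n → ℕ} (T : IsTRDF G g) where

  gadget≥2-via-w : ∀ {k} → NoNewNeighbours G (w k) → 2 ≤ gadget g k
  gadget≥2-via-w {k} noNew with ∃-neighbour-sum≥2 T (w k)
  ... | _ , wy , 2≤ with noNew wy
  ...   | wu _ = ≤-trans 2≤ (w+u≤gadget g k)
  ...   | wv _ = ≤-trans 2≤ (w+v≤gadget g k)

  private
    positive : ∀ {x} → g c ≤ 1 → 2 ≤ g x + g c → 1 ≤ g x
    positive gc≤1 2≤ = +-cancelʳ-≤ 1 1 _ (≤-trans 2≤ (+-monoʳ-≤ _ gc≤1))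

  u-positive⊎gadget≥2 : ∀ {k} → g c ≤ 1 → NoNewNeighbours G (u k) → 1 ≤ g (u k) ⊎ 2 ≤ gadget g k
  u-positive⊎gadget≥2 {k} gc≤1 noNew with ∃-neighbour-sum≥2 T (u k)
  ... | _ , uy , 2≤ with noNew uy
  ...   | uc _ = inj₁ (positive gc≤1 2≤)
  ...   | uv _ = inj₂ (≤-trans 2≤ (u+v≤gadget g k))
  ...   | uw _ = inj₂ (≤-trans 2≤ (u+w≤gadget g k))

  v-positive⊎gadget≥2 : ∀ {k} → g c ≤ 1 → NoNewNeighbours G (v k) → 1 ≤ g (v k) ⊎ 2 ≤ gadget g k
  v-positive⊎gadget≥2 {k} gc≤1 noNew with ∃-neighbour-sum≥2 T (v k)
  ... | _ , vy , 2≤ with noNew vy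
  ...   | vc _ = inj₁ (positive gc≤1 2≤)
  ...   | vu _ = inj₂ (≤-trans 2≤ (v+u≤gadget g k))
  ...   | vw _ = inj₂ (≤-trans 2≤ (v+w≤gadget g k))

  gadget≥2-via-uv : ∀ {k} → g c ≤ 1 → NoNewNeighbours G (u k) → NoNewNeighbours G (v k) →
                    2 ≤ gadget g k
  gadget≥2-via-uv {k} gc≤1 noNewU noNewV
    with u-positive⊎gadget≥2 gc≤1 noNewU | v-positive⊎gadget≥2 gc≤1 noNewV
  ... | inj₂ 2≤  | _        = 2≤
  ... | _        | inj₂ 2≤  = 2≤
  ... | inj₁ 1≤u | inj₁ 1≤v = ≤-trans (+-mono-≤ 1≤u 1≤v) (u+v≤gadget g k)

gadget+gadget≥2 : ∀ {n} {i j : Fin n} {g : Vtx n → ℕ} → i ≢ j →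
                  IsTRDF (addEdge (D n) (w i) (w j)) g → 2 ≤ gadget g i + gadget g j
gadget+gadget≥2 {i = i} {j} {g} i≢j T with ∃-neighbour-sum≥2 T (w i)
... | _ , inj₁ (wu _) , 2≤ = ≤-trans 2≤ (≤-trans (w+u≤gadget g i) (m≤m+n _ _))
... | _ , inj₁ (wv _) , 2≤ = ≤-trans 2≤ (≤-trans (w+v≤gadget g i) (m≤m+n _ _))
... | _ , inj₂ (inj₁ (_ , refl)) , 2≤ =
  ≤-trans 2≤ (+-mono-≤ (m≤n+m (g (w i)) (g (u i) + g (v i)))
                       (m≤n+m (g (w j)) (g (u j) + g (v j))))
... | _ , inj₂ (inj₂ (wi≡wj , _)) , _ = contradiction (w-injective wi≡wj) i≢j

∃-gadget≥3 : ∀ {n} {g : Vtx n → ℕ} → IsTRDF (D n) g → g c ≡ 0 → Σ (Fin n) λ m → 3 ≤ gadget g m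
∃-gadget≥3 {g = g} T gc≡0 with IsTRDF.dominate T c gc≡0
... | _ , cu m , gu≡2 with IsTRDF.total T (u m) (subst (0 <_) (sym gu≡2) z<s)
...   | _ , uc _ , gc>0 = contradiction (subst (0 <_) gc≡0 gc>0) n≮0
...   | _ , uv _ , gy>0 = m , ≤-trans (+-mono-≤ (≤-reflexive (sym gu≡2)) gy>0) (u+v≤gadget g m)
...   | _ , uw _ , gy>0 = m , ≤-trans (+-mono-≤ (≤-reflexive (sym gu≡2)) gy>0) (u+w≤gadget g m)
∃-gadget≥3 {g = g} T gc≡0
    | _ , cv m , gv≡2 with IsTRDF.total T (v m) (subst (0 <_) (sym gv≡2) z<s)
...   | _ , vc _ , gc>0 = contradiction (subst (0 <_) gc≡0 gc>0) n≮0
...   | _ , vu _ , gy>0 = m , ≤-trans (+-mono-≤ (≤-reflexive (sym gv≡2)) gy>0) (v+u≤gadget g m)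
...   | _ , vw _ , gy>0 = m , ≤-trans (+-mono-≤ (≤-reflexive (sym gv≡2)) gy>0) (v+w≤gadget g m)

-- Lower bounds

D-noNewNeighbours : ∀ {n} z → NoNewNeighbours (D n) z
D-noNewNeighbours z zy = zy

D-lowerBound : ∀ {n} {g : Vtx (suc n) → ℕ} → IsTRDF (D (suc n)) g →
               suc (suc n * 2) ≤ g c + sum (gadget g)
D-lowerBound {n} {g} T with g c ℕ.≟ 0
... | no gc≢0 = +-mono-≤ (n≢0⇒n>0 gc≢0) (sum-≥ λ k → gadget≥2-via-w T (D-noNewNeighbours (w k)))
... | yes gc≡0 =
  let m , 3≤gm = ∃-gadget≥3 T gc≡0 in
  ≤-trans (+-monoˡ-≤ (n * 2) 3≤gm)
          (≤-trans (sum-≥-except (gadget g) m (λ k _ → gadget≥2-via-w T (D-noNewNeighbours (w k))))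
                   (m≤n+m _ (g c)))

addEdge-lowerBound : ∀ {n} {i : Fin (suc n)} {x} {g : Vtx (suc n) → ℕ} →
                     u i ≢ x → v i ≢ x → (∀ k → w k ≢ x) →
                     IsTRDF (addEdge (D (suc n)) (w i) x) g → suc n * 2 ≤ g c + sum (gadget g)
addEdge-lowerBound {n} {i} {x} {g} ui≢x vi≢x wk≢x T with g c ≤? 1
... | yes gc≤1 = ≤-trans (sum-≥ gadget≥2) (m≤n+m _ (g c))
  where
  gadget≥2 : ∀ k → 2 ≤ gadget g k
  gadget≥2 k with k ≟ i
  ... | yes refl = gadget≥2-via-uv T gc≤1 (addEdge-noNewNeighbours (λ ()) ui≢x)
                                          (addEdge-noNewNeighbours (λ ()) vi≢x)
  ... | no k≢i   = gadget≥2-via-w T (addEdge-noNewNeighbours (k≢i ∘ w-injective) (wk≢x k))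
... | no gc≰1 =
  +-mono-≤ (≰⇒> gc≰1)
    (≤-trans (m≤n+m (n * 2) (gadget g i))
      (sum-≥-except (gadget g) i λ k k≢i →
        gadget≥2-via-w T (addEdge-noNewNeighbours (k≢i ∘ w-injective) (wk≢x k))))

addEdge-ww-lowerBound : ∀ {n} {i j : Fin (suc (suc n))} {g : Vtx (suc (suc n)) → ℕ} → i ≢ j →
                       IsTRDF (addEdge (D (suc (suc n))) (w i) (w j)) g →
                       suc (suc n) * 2 ≤ g c + sum (gadget g)
addEdge-ww-lowerBound {n} {i} {j} {g} i≢j T with g c ≤? 1
... | yes gc≤1 = ≤-trans (sum-≥ gadget≥2) (m≤n+m _ (g c))
  where
  gadget≥2 : ∀ k → 2 ≤ gadget g k
  gadget≥2 k with k ≟ i | k ≟ j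
  ... | yes refl | _ = gadget≥2-via-uv T gc≤1 (addEdge-noNewNeighbours (λ ()) (λ ()))
                                              (addEdge-noNewNeighbours (λ ()) (λ ()))
  ... | _ | yes refl = gadget≥2-via-uv T gc≤1 (addEdge-noNewNeighbours (λ ()) (λ ()))
                                              (addEdge-noNewNeighbours (λ ()) (λ ()))
  ... | no k≢i | no k≢j =
    gadget≥2-via-w T (addEdge-noNewNeighbours (k≢i ∘ w-injective) (k≢j ∘ w-injective))
... | no gc≰1 =
  +-mono-≤ (≰⇒> gc≰1)
    (≤-trans (+-monoˡ-≤ (n * 2) (gadget+gadget≥2 i≢j T))
      (sum-≥-except₂ (gadget g) i≢j λ k k≢i k≢j →
        gadget≥2-via-w T (addEdge-noNewNeighbours (k≢i ∘ w-injective) (k≢j ∘ w-injective))))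

-- Optimal functions

D-witness : ∀ {n} → Vtx n → ℕ
D-witness c     = 1
D-witness (u _) = 2
D-witness (v _) = 0
D-witness (w _) = 0

D-witness-isTRDF : ∀ {n} → Fin n → IsTRDF (D n) D-witness
D-witness-isTRDF {n} t = record { values = values ; dominate = dominate ; total = total }
  where
  values : ∀ x → D-witness x ≤ 2
  values c     = s≤s z≤n
  values (u _) = ≤-refl
  values (v _) = z≤n
  values (w _) = z≤n
  dominate : ∀ x → D-witness x ≡ 0 → Σ (Vtx n) λ y → D n x y × D-witness y ≡ 2
  dominate (v k) _ = u k , vu k , refl
  dominate (w k) _ = u k , wu k , refl
  total : ∀ x → 0 < D-witness x → Σ (Vtx n) λ y → D n x y × 0 < D-witness y
  total c     _ = u t , cu t , z<s
  total (u k) _ = c , uc k , z<s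

D-witness-weight : ∀ n → D-witness {n} c + sum (gadget (D-witness {n})) ≡ suc (n * 2)
D-witness-weight n = cong suc (sum-≡ {n} λ _ → refl)

data Side : Set where
  onU onV : Side

spoke : ∀ {n} → Side → Fin n → Vtx n
spoke onU = u
spoke onV = v

c-spoke : ∀ {n} s (k : Fin n) → D n c (spoke s k)
c-spoke onU = cu
c-spoke onV = cv

w-spoke : ∀ {n} s (k : Fin n) → D n (w k) (spoke s k)
w-spoke onU = wu
w-spoke onV = wv

twoUnless : ∀ {n} → Fin n → Fin n → ℕ
twoUnless i k = if does (k ≟ i) then 0 else 2

twoUnless-≤ : ∀ {n} (i k : Fin n) → twoUnless i k ≤ 2
twoUnless-≤ i k with does (k ≟ i)
... | true  = z≤n
... | false = ≤-refl

twoUnless-≡ : ∀ {n} (i : Fin n) → twoUnless i i ≡ 0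
twoUnless-≡ i rewrite dec-true (i ≟ i) refl = refl

twoUnless-≢ : ∀ {n} {i k : Fin n} → k ≢ i → twoUnless i k ≡ 2
twoUnless-≢ {i = i} {k} k≢i rewrite dec-false (k ≟ i) k≢i = refl

star : ∀ {n} → Side → Fin n → Vtx n → ℕ
star s   i c     = 2
star onU i (u k) = twoUnless i k
star onV i (u k) = 0
star onU i (v k) = 0
star onV i (v k) = twoUnless i k
star s   i (w k) = 0

star-≤2 : ∀ {n} s (i : Fin n) y → star s i y ≤ 2
star-≤2 s   i c     = ≤-refl
star-≤2 onU i (u k) = twoUnless-≤ i k
star-≤2 onV i (u k) = z≤n
star-≤2 onU i (v k) = z≤n
star-≤2 onV i (v k) = twoUnless-≤ i k
star-≤2 s   i (w k) = z≤n

star-spoke : ∀ {n} s (i k : Fin n) → star s i (spoke s k) ≡ twoUnless i k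
star-spoke onU i k = refl
star-spoke onV i k = refl

gadget-star : ∀ {n} s (i k : Fin n) → gadget (star s i) k ≡ twoUnless i k
gadget-star onU i k = trans (+-identityʳ _) (+-identityʳ _)
gadget-star onV i k = +-identityʳ _

star-isTRDF : ∀ {n} s {i t : Fin n} {x} → t ≢ i → star s i x ≡ 2 →
              IsTRDF (addEdge (D n) (w i) x) (star s i)
star-isTRDF {n} s {i} {t} {x} t≢i sx≡2 =
  record { values = star-≤2 s i ; dominate = dominate ; total = total }
  where
  G = addEdge (D n) (w i) x
  dominate : ∀ y → star s i y ≡ 0 → Σ (Vtx n) λ z → G y z × star s i z ≡ 2
  dominate (u k) _ = c , inj₁ (uc k) , refl
  dominate (v k) _ = c , inj₁ (vc k) , refl
  dominate (w k) _ with k ≟ i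
  ... | yes refl = x , inj₂ (inj₁ (refl , refl)) , sx≡2
  ... | no k≢i   = spoke s k , inj₁ (w-spoke s k) , trans (star-spoke s i k) (twoUnless-≢ k≢i)
  total : ∀ y → 0 < star s i y → Σ (Vtx n) λ z → G y z × 0 < star s i z
  total c     _ = spoke s t , inj₁ (c-spoke s t) ,
                  subst (0 <_) (sym (trans (star-spoke s i t) (twoUnless-≢ t≢i))) z<s
  total (u k) _ = c , inj₁ (uc k) , z<s
  total (v k) _ = c , inj₁ (vc k) , z<s

star-weight : ∀ {n} s (i : Fin (suc n)) → star s i c + sum (gadget (star s i)) ≡ suc n * 2
star-weight {n} s i = cong (2 +_) (begin
  sum (gadget (star s i))        ≡⟨ sum-≡-except (gadget (star s i)) i
                                      (λ k k≢i → trans (gadget-star s i k) (twoUnless-≢ k≢i)) ⟩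
  gadget (star s i) i + n * 2    ≡⟨ cong (_+ n * 2) (trans (gadget-star s i i) (twoUnless-≡ i)) ⟩
  n * 2                          ∎)
  where open ≡-Reasoning

inPair : ∀ {n} → Fin n → Fin n → Fin n → Bool
inPair i j k = does (k ≟ i ⊎-dec k ≟ j)

inPair-ˡ : ∀ {n} (i j : Fin n) → inPair i j i ≡ true
inPair-ˡ i j = dec-true (i ≟ i ⊎-dec i ≟ j) (inj₁ refl)

inPair-ʳ : ∀ {n} (i j : Fin n) → inPair i j j ≡ true
inPair-ʳ i j = dec-true (j ≟ i ⊎-dec j ≟ j) (inj₂ refl)

inPair-≢ : ∀ {n} {i j k : Fin n} → k ≢ i → k ≢ j → inPair i j k ≡ false
inPair-≢ {i = i} {j} {k} k≢i k≢j = dec-false (k ≟ i ⊎-dec k ≟ j) [ k≢i , k≢j ]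

pairWitness : ∀ {n} → Fin n → Fin n → Vtx n → ℕ
pairWitness i j c     = 2
pairWitness i j (u k) = if inPair i j k then 0 else 2
pairWitness i j (v k) = 0
pairWitness i j (w k) = if inPair i j k then 1 else 0

pairWitness-≤2 : ∀ {n} (i j : Fin n) y → pairWitness i j y ≤ 2
pairWitness-≤2 i j c = ≤-refl
pairWitness-≤2 i j (u k) with inPair i j k
... | true  = z≤n
... | false = ≤-refl
pairWitness-≤2 i j (v k) = z≤n
pairWitness-≤2 i j (w k) with inPair i j k
... | true  = s≤s z≤n
... | false = z≤n

gadget-pairWitness : ∀ {n} (i j k : Fin n) →
                     gadget (pairWitness i j) k ≡ (if inPair i j k then 1 else 2)
gadget-pairWitness i j k with inPair i j k
... | true  = refl
... | false = refl

pairWitness-isTRDF : ∀ {n} {i j t : Fin n} → t ≢ i → t ≢ j →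
                     IsTRDF (addEdge (D n) (w i) (w j)) (pairWitness i j)
pairWitness-isTRDF {n} {i} {j} {t} t≢i t≢j =
  record { values = pairWitness-≤2 i j ; dominate = dominate ; total = total }
  where
  G = addEdge (D n) (w i) (w j)
  f = pairWitness i j
  u-off-pair : ∀ {k} → k ≢ i → k ≢ j → f (u k) ≡ 2
  u-off-pair k≢i k≢j = cong (λ b → if b then 0 else 2) (inPair-≢ k≢i k≢j)
  w-on-pair : ∀ {k} → inPair i j k ≡ true → f (w k) ≡ 1
  w-on-pair = cong (λ b → if b then 1 else 0)
  dominate : ∀ y → f y ≡ 0 → Σ (Vtx n) λ z → G y z × f z ≡ 2
  dominate (u k) _ = c , inj₁ (uc k) , refl
  dominate (v k) _ = c , inj₁ (vc k) , refl
  dominate (w k) _ with k ≟ i | k ≟ j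
  ... | no k≢i | no k≢j = u k , inj₁ (wu k) , u-off-pair k≢i k≢j
  total : ∀ y → 0 < f y → Σ (Vtx n) λ z → G y z × 0 < f z
  total c     _ = u t , inj₁ (cu t) , subst (0 <_) (sym (u-off-pair t≢i t≢j)) z<s
  total (u k) _ = c , inj₁ (uc k) , z<s
  total (w k) fwk>0 with k ≟ i | k ≟ j
  ... | yes refl | _        =
    w j , inj₂ (inj₁ (refl , refl)) , subst (0 <_) (sym (w-on-pair {j} (inPair-ʳ i j))) z<s
  ... | no _     | yes refl =
    w i , inj₂ (inj₂ (refl , refl)) , subst (0 <_) (sym (w-on-pair {i} (inPair-ˡ i j))) z<s
  ... | no _     | no _     = contradiction fwk>0 n≮0

pairWitness-weight : ∀ {n} {i j : Fin (suc (suc n))} → i ≢ j →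
                     pairWitness i j c + sum (gadget (pairWitness i j)) ≡ suc (suc n) * 2
pairWitness-weight {n} {i} {j} i≢j = cong (2 +_) (begin
  sum (gadget f)                   ≡⟨ sum-≡-except₂ (gadget f) i≢j (λ k k≢i k≢j →
                                        trans (gadget-pairWitness i j k) (cong endGadget (inPair-≢ k≢i k≢j))) ⟩
  gadget f i + gadget f j + n * 2  ≡⟨ cong₂ (λ a b → a + b + n * 2)
                                        (trans (gadget-pairWitness i j i) (cong endGadget (inPair-ˡ i j)))
                                        (trans (gadget-pairWitness i j j) (cong endGadget (inPair-ʳ i j))) ⟩
  2 + n * 2                        ∎)
  where
  open ≡-Reasoning
  f = pairWitness i j
  endGadget : Bool → ℕ
  endGadget b = if b then 1 else 2

isγtR : ∀ {n} {G : Graph (Vtx n)} {L} (f : Vtx n → ℕ) → IsTRDF G f → f c + sum (gadget f) ≡ L →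
        (∀ {g} → IsTRDF G g → L ≤ g c + sum (gadget g)) → IsγtR G L
isγtR f Tf f≡L L≤ = (f , Tf , trans (weight≡centre+gadgets f) f≡L) ,
                    λ g Tg → ≤-trans (L≤ Tg) (≤-reflexive (sym (weight≡centre+gadgets g)))

γtR-D : ∀ n → IsγtR (D (suc n)) (suc (suc n * 2))
γtR-D n = isγtR D-witness (D-witness-isTRDF zero) (D-witness-weight (suc n)) D-lowerBound

γtR-addEdge : ∀ {n} (i : Fin (suc (suc (suc n)))) x → IsComplementEdge (D _) (w i) x →
              IsγtR (addEdge (D _) (w i) x) (suc (suc (suc n)) * 2)
γtR-addEdge i c _ =
  isγtR (star onU i) (star-isTRDF onU (punchInᵢ≢i i zero) refl) (star-weight onU i)
        (addEdge-lowerBound (λ ()) (λ ()) (λ _ ()))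
γtR-addEdge i (u j) (_ , wi≁uj) =
  isγtR (star onU i) (star-isTRDF onU j≢i (twoUnless-≢ j≢i)) (star-weight onU i)
        (addEdge-lowerBound (λ { refl → j≢i refl }) (λ ()) (λ _ ()))
  where
  j≢i : j ≢ i
  j≢i refl = wi≁uj (wu j)
γtR-addEdge i (v j) (_ , wi≁vj) =
  isγtR (star onV i) (star-isTRDF onV j≢i (twoUnless-≢ j≢i)) (star-weight onV i)
        (addEdge-lowerBound (λ ()) (λ { refl → j≢i refl }) (λ _ ()))
  where
  j≢i : j ≢ i
  j≢i refl = wi≁vj (wv j)
γtR-addEdge i (w j) (wi≢wj , _) =
  isγtR (pairWitness i j) (pairWitness-isTRDF (punchIn₂≢ˡ i≢j zero) (punchIn₂≢ʳ i≢j zero))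
        (pairWitness-weight i≢j) (addEdge-ww-lowerBound i≢j)
  where
  i≢j : i ≢ j
  i≢j = wi≢wj ∘ cong w

mainTheorem18 : (n : ℕ) → 3 ≤ n → (i : Fin n) → (x : Vtx n) →
    IsComplementEdge (D n) (w i) x →
    Σ ℕ (λ a → Σ ℕ (λ b →
      IsγtR (addEdge (D n) (w i) x) a × IsγtR (D n) b × a < b))
mainTheorem18 _ (s≤s (s≤s (s≤s _))) i x nonEdge =
  _ , _ , γtR-addEdge i x nonEdge , γtR-D _ , ≤-refl
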